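{- Let $G=(V,E)$ and $G'=(V',E')$ be finite simple graphs with $V\cap V'=\emptyset$, and let $G\oplus_{v}G'$ be the vertex sum formed by identifying $u\in V$ and $u'\in V'$ into the vertex $v$. Suppose $F\subseteq V$ and $F'\subseteq V'$ are minimal forts of $G$ and $G'$, respectively, with $u\in F$ and $u'\in F'$. Then \[\hat{F} = \left(F\setminus\{u\}\right)\cup\left(F'\setminus\{u'\}\right)\cup\{v\}\] is a fort of $G\oplus_{v}G'$. Moreover, $\hat{F}$ is a minimal fort of $G\oplus_{v}G'$ if and only if $\hat{F}\setminus\{v\}$ does not contain a fort of $G\oplus_{v}G'$.
   Context: A fort of a finite simple graph $H$ is a non-empty subset $F$ of its vertices such that no vertex outside $F$ has exactly one neighbor in $F$; a fort is minimal if no proper subset of it is a fort. The vertex sum $G\oplus_v G'$ has vertex set $(V\setminus\{u\})\cup(V'\setminus\{u'\})\cup\{v\}$; its edges are those of $G$ not incident to $u$, those of $G'$ not incident to $u'$, and the edges $\{v,w\}$ for $w\in N_G(u)\cup N_{G'}(u')$. -}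

module Defs where

open import Data.Nat using (ℕ; suc; _+_)
open import Data.Fin using (Fin; zero; suc; splitAt; punchIn)
open import Data.Fin.Subset using (Subset; _∈_; _∉_; _⊆_; _⊂_; Nonempty; _-_)
open import Data.Bool using (Bool; true; false)
open import Data.Unit using (⊤; tt)
open import Data.Sum using (_⊎_; inj₁; inj₂)
open import Data.Product using (Σ; _×_; _,_)
open import Data.Vec using (lookup; tabulate)
open import Relation.Nullary using (¬_)
open import Relation.Binary.PropositionalEquality using (_≡_; refl)

record Graph (n : ℕ) : Set where
  field
    Adj    : Fin n → Fin n → Bool
    sym    : ∀ x y → Adj x y ≡ Adj y x
    irrefl : ∀ x → Adj x x ≡ false

open Graph public

ExactlyOneNbrIn : ∀ {n} → Graph n → Subset n → Fin n → Set
ExactlyOneNbrIn G F w =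
  Σ (Fin _) λ x → x ∈ F × Adj G w x ≡ true
                × (∀ y → y ∈ F → Adj G w y ≡ true → y ≡ x)

IsFort : ∀ {n} → Graph n → Subset n → Set
IsFort G F = Nonempty F × (∀ w → w ∉ F → ¬ ExactlyOneNbrIn G F w)

IsMinimalFort : ∀ {n} → Graph n → Subset n → Set
IsMinimalFort G F = IsFort G F × (∀ S → S ⊂ F → ¬ IsFort G S)

-- The vertex sum lives on
-- Fin (suc (m + k)): zero is the new vertex v, suc (i ↑ˡ k) is the
-- vertex  punchIn u i  of V \ {u}, and suc (m ↑ʳ j) is the vertex
-- punchIn u' j  of V' \ {u'}  (disjoint union built in).

SumView : ℕ → ℕ → Set
SumView m k = ⊤ ⊎ (Fin m ⊎ Fin k)

sumView : ∀ m k → Fin (suc (m + k)) → SumView m k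
sumView m k zero    = inj₁ tt
sumView m k (suc i) = inj₂ (splitAt m i)

module _ {m k : ℕ} (G : Graph (suc m)) (u : Fin (suc m))
                   (G' : Graph (suc k)) (u' : Fin (suc k)) where

  viewAdj : SumView m k → SumView m k → Bool
  viewAdj (inj₁ _)        (inj₁ _)         = false
  viewAdj (inj₁ _)        (inj₂ (inj₁ i))  = Adj G u (punchIn u i)
  viewAdj (inj₁ _)        (inj₂ (inj₂ j))  = Adj G' u' (punchIn u' j)
  viewAdj (inj₂ (inj₁ i)) (inj₁ _)         = Adj G (punchIn u i) u
  viewAdj (inj₂ (inj₂ j)) (inj₁ _)         = Adj G' (punchIn u' j) u'
  viewAdj (inj₂ (inj₁ i)) (inj₂ (inj₁ i')) = Adj G (punchIn u i) (punchIn u i')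
  viewAdj (inj₂ (inj₂ j)) (inj₂ (inj₂ j')) = Adj G' (punchIn u' j) (punchIn u' j')
  viewAdj (inj₂ (inj₁ _)) (inj₂ (inj₂ _))  = false
  viewAdj (inj₂ (inj₂ _)) (inj₂ (inj₁ _))  = false

  viewAdj-sym : ∀ a b → viewAdj a b ≡ viewAdj b a
  viewAdj-sym (inj₁ _)        (inj₁ _)         = refl
  viewAdj-sym (inj₁ _)        (inj₂ (inj₁ i))  = sym G u (punchIn u i)
  viewAdj-sym (inj₁ _)        (inj₂ (inj₂ j))  = sym G' u' (punchIn u' j)
  viewAdj-sym (inj₂ (inj₁ i)) (inj₁ _)         = sym G (punchIn u i) u
  viewAdj-sym (inj₂ (inj₂ j)) (inj₁ _)         = sym G' (punchIn u' j) u'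
  viewAdj-sym (inj₂ (inj₁ i)) (inj₂ (inj₁ i')) = sym G (punchIn u i) (punchIn u i')
  viewAdj-sym (inj₂ (inj₂ j)) (inj₂ (inj₂ j')) = sym G' (punchIn u' j) (punchIn u' j')
  viewAdj-sym (inj₂ (inj₁ _)) (inj₂ (inj₂ _))  = refl
  viewAdj-sym (inj₂ (inj₂ _)) (inj₂ (inj₁ _))  = refl

  viewAdj-irrefl : ∀ a → viewAdj a a ≡ false
  viewAdj-irrefl (inj₁ _)        = refl
  viewAdj-irrefl (inj₂ (inj₁ i)) = irrefl G (punchIn u i)
  viewAdj-irrefl (inj₂ (inj₂ j)) = irrefl G' (punchIn u' j)

  vertexSum : Graph (suc (m + k))
  vertexSum = record
    { Adj    = λ x y → viewAdj (sumView m k x) (sumView m k y)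
    ; sym    = λ x y → viewAdj-sym (sumView m k x) (sumView m k y)
    ; irrefl = λ x → viewAdj-irrefl (sumView m k x)
    }

  vNew : Fin (suc (m + k))
  vNew = zero

  fHatSide : Subset (suc m) → Subset (suc k) → SumView m k → Bool
  fHatSide F F' (inj₁ _)        = true
  fHatSide F F' (inj₂ (inj₁ i)) = lookup F (punchIn u i)
  fHatSide F F' (inj₂ (inj₂ j)) = lookup F' (punchIn u' j)

  fHat : Subset (suc m) → Subset (suc k) → Subset (suc (m + k))
  fHat F F' = tabulate (λ x → fHatSide F F' (sumView m k x))

{-# OPTIONS --safe #-}
-- Each summand G sits in G ⊕ᵥ G' as an induced copy with u placed at v, and every vertex of
-- the copy other than v keeps its whole neighbourhood inside it. So at such a vertex, having
-- exactly one neighbour in a set S means the same in G ⊕ᵥ G' as having exactly one neighbour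
-- in the pullback of S to G. F̂ pulls back to F and F', hence is a fort. A fort S ⊂ F̂ through v
-- pulls back to forts of G and G' inside F and F', one of them proper, contradicting
-- minimality; so only forts avoiding v can make F̂ non-minimal.
module Submission where

open import Defs renaming (sym to adj-sym; irrefl to adj-irrefl)
open import Data.Nat using (ℕ; suc; _+_)
open import Data.Fin using (Fin; zero; suc; _↑ˡ_; _↑ʳ_; splitAt; punchIn; punchOut; _≟_)
open import Data.Fin.Properties
  using (suc-injective; ↑ˡ-injective; ↑ʳ-injective; splitAt-↑ˡ; splitAt-↑ʳ; splitAt⁻¹-↑ˡ; splitAt⁻¹-↑ʳ;
         punchInᵢ≢i; punchIn-punchOut; punchOut-cong; punchOut-punchIn)
open import Data.Fin.Subset using (Subset; _∈_; _∉_; _⊆_; _⊂_; _-_; Nonempty)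
open import Data.Fin.Subset.Properties using (_∈?_; ⊆-⊂-trans; x∈p⇒p-x⊂p; x∈p∧x≢y⇒x∈p-y)
open import Data.Bool using (true)
open import Data.Sum using (_⊎_; inj₁; inj₂)
open import Data.Product using (Σ; ∃; _×_; _,_; proj₁)
open import Data.Vec using (lookup; tabulate; here)
open import Data.Vec.Properties using (lookup∘tabulate; tabulate∘lookup; tabulate-cong; []=⇒lookup; lookup⇒[]=)
open import Function using (_∘_)
open import Function.Bundles using (_⇔_; mk⇔)
open import Function.Definitions using (Injective)
open import Relation.Nullary using (¬_; yes; no; contradiction)
open import Relation.Binary.PropositionalEquality using (_≡_; refl; sym; trans; cong; subst)

ContainsFort : ∀ {n} → Graph n → Subset n → Set
ContainsFort G P = Σ (Subset _) λ S → S ⊆ P × IsFort G S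

module _ {n} {G : Graph n} {T : Subset n} {y : Fin n} where

  minimalFort⇒¬containsFort- : IsMinimalFort G T → y ∈ T → ¬ ContainsFort G (T - y)
  minimalFort⇒¬containsFort- (_ , minimal) y∈T (S , S⊆T-y , fortS) =
    minimal S (⊆-⊂-trans S⊆T-y (x∈p⇒p-x⊂p y∈T)) fortS

  isMinimalFort⁺ : IsFort G T → ¬ ContainsFort G (T - y) →
                   (∀ S → S ⊂ T → y ∈ S → ¬ IsFort G S) → IsMinimalFort G T
  isMinimalFort⁺ fortT noFortAvoiding noFortThrough = fortT , properSubforts
    where
    properSubforts : ∀ S → S ⊂ T → ¬ IsFort G S
    properSubforts S S⊂T@(S⊆T , _) fortS with y ∈? S
    ... | yes y∈S = noFortThrough S S⊂T y∈S fortS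
    ... | no  y∉S = noFortAvoiding (S , S⊆T-y , fortS)
      where
      S⊆T-y : S ⊆ T - y
      S⊆T-y x∈S = x∈p∧x≢y⇒x∈p-y (S⊆T x∈S) λ { refl → y∉S x∈S }

record InducedEmbedding {a b} (A : Graph a) (B : Graph b) : Set where
  field
    embed     : Fin a → Fin b
    injective : Injective _≡_ _≡_ embed
    adj-embed : ∀ x y → Adj B (embed x) (embed y) ≡ Adj A x y

module _ {a b} {A : Graph a} {B : Graph b} (ι : InducedEmbedding A B) where
  open InducedEmbedding ι

  NbrsEmbedded : Fin a → Set
  NbrsEmbedded x = ∀ y → Adj B (embed x) y ≡ true → ∃ λ z → embed z ≡ y

  pullback : Subset b → Subset a
  pullback S = tabulate (lookup S ∘ embed)

  ∈-pullback⁺ : ∀ {S x} → embed x ∈ S → x ∈ pullback S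
  ∈-pullback⁺ {x = x} ιx∈S = lookup⇒[]= x _ (trans (lookup∘tabulate _ x) ([]=⇒lookup ιx∈S))

  ∈-pullback⁻ : ∀ {S x} → x ∈ pullback S → embed x ∈ S
  ∈-pullback⁻ {S} {x} x∈S* = lookup⇒[]= (embed x) S (trans (sym (lookup∘tabulate _ x)) ([]=⇒lookup x∈S*))

  module _ {S : Subset b} {x : Fin a} where

    exactlyOneNbrIn-pullback⁺ : NbrsEmbedded x →
      ExactlyOneNbrIn B S (embed x) → ExactlyOneNbrIn A (pullback S) x
    exactlyOneNbrIn-pullback⁺ nbrs (y , y∈S , ιx~y , unique) with nbrs y ιx~y
    ... | z , refl = z , ∈-pullback⁺ y∈S , trans (sym (adj-embed x z)) ιx~y , unique′
      where
      unique′ : ∀ z′ → z′ ∈ pullback S → Adj A x z′ ≡ true → z′ ≡ z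
      unique′ z′ z′∈S* x~z′ = injective (unique (embed z′) (∈-pullback⁻ z′∈S*) (trans (adj-embed x z′) x~z′))

    exactlyOneNbrIn-pullback⁻ : NbrsEmbedded x →
      ExactlyOneNbrIn A (pullback S) x → ExactlyOneNbrIn B S (embed x)
    exactlyOneNbrIn-pullback⁻ nbrs (z , z∈S* , x~z , unique) =
      embed z , ∈-pullback⁻ z∈S* , trans (adj-embed x z) x~z , unique′
      where
      unique′ : ∀ y → y ∈ S → Adj B (embed x) y ≡ true → y ≡ embed z
      unique′ y y∈S ιx~y with nbrs y ιx~y
      ... | z′ , refl = cong embed (unique z′ (∈-pullback⁺ y∈S) (trans (sym (adj-embed x z′)) ιx~y))

    pullback-isFort⇒¬exactlyOneNbrIn : IsFort A (pullback S) → NbrsEmbedded x →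
      embed x ∉ S → ¬ ExactlyOneNbrIn B S (embed x)
    pullback-isFort⇒¬exactlyOneNbrIn (_ , fort) nbrs ιx∉S =
      fort x (ιx∉S ∘ ∈-pullback⁻) ∘ exactlyOneNbrIn-pullback⁺ nbrs

  pullback-isFort : ∀ {S} → IsFort B S → Nonempty (pullback S) →
    (∀ x → x ∉ pullback S → NbrsEmbedded x) → IsFort A (pullback S)
  pullback-isFort (_ , fort) nonempty nbrs =
    nonempty , λ x x∉S* → fort (embed x) (x∉S* ∘ ∈-pullback⁺) ∘ exactlyOneNbrIn-pullback⁻ (nbrs x x∉S*)

  pullback-⊂ : ∀ {S T x} → S ⊆ T → embed x ∈ T → embed x ∉ S → pullback S ⊂ pullback T
  pullback-⊂ {x = x} S⊆T ιx∈T ιx∉S =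
    ∈-pullback⁺ ∘ S⊆T ∘ ∈-pullback⁻ , x , ∈-pullback⁺ ιx∈T , ιx∉S ∘ ∈-pullback⁻

≡⊎punchIn : ∀ {n} (u x : Fin (suc n)) → x ≡ u ⊎ ∃ λ i → x ≡ punchIn u i
≡⊎punchIn u x with u ≟ x
... | yes u≡x = inj₁ (sym u≡x)
... | no  u≢x = inj₂ (punchOut u≢x , sym (punchIn-punchOut u≢x))

record Gluing {N n} (H : Graph (suc N)) (G : Graph (suc n)) (u : Fin (suc n)) : Set where
  field
    inject           : Fin n → Fin N
    inject-injective : Injective _≡_ _≡_ inject
    adj-inject       : ∀ i j → Adj H (suc (inject i)) (suc (inject j)) ≡ Adj G (punchIn u i) (punchIn u j)
    adj-zero-inject  : ∀ i → Adj H zero (suc (inject i)) ≡ Adj G u (punchIn u i)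
    nbrs-inject      : ∀ i y → Adj H (suc (inject i)) (suc y) ≡ true → ∃ λ j → inject j ≡ y

module _ {N n} {H : Graph (suc N)} {G : Graph (suc n)} {u : Fin (suc n)} (gl : Gluing H G u) where
  open Gluing gl

  glue : Fin (suc n) → Fin (suc N)
  glue x with u ≟ x
  ... | yes _   = zero
  ... | no  u≢x = suc (inject (punchOut u≢x))

  glue-u : glue u ≡ zero
  glue-u with u ≟ u
  ... | yes _   = refl
  ... | no  u≢u = contradiction refl u≢u

  glue-punchIn : ∀ i → glue (punchIn u i) ≡ suc (inject i)
  glue-punchIn i with u ≟ punchIn u i
  ... | yes u≡ = contradiction (sym u≡) (punchInᵢ≢i u i)
  ... | no  _  = cong (suc ∘ inject) (trans (punchOut-cong u refl) (punchOut-punchIn u))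

  adj-glue : ∀ x y → Adj H (glue x) (glue y) ≡ Adj G x y
  adj-glue x y with ≡⊎punchIn u x | ≡⊎punchIn u y
  ... | inj₁ refl       | inj₁ refl       rewrite glue-u =
    trans (adj-irrefl H zero) (sym (adj-irrefl G u))
  ... | inj₁ refl       | inj₂ (j , refl) rewrite glue-u | glue-punchIn j = adj-zero-inject j
  ... | inj₂ (i , refl) | inj₁ refl       rewrite glue-u | glue-punchIn i =
    trans (adj-sym H _ zero) (trans (adj-zero-inject i) (adj-sym G u _))
  ... | inj₂ (i , refl) | inj₂ (j , refl) rewrite glue-punchIn i | glue-punchIn j = adj-inject i j

  glue-injective : Injective _≡_ _≡_ glue
  glue-injective {x} {y} eq with ≡⊎punchIn u x | ≡⊎punchIn u y
  ... | inj₁ refl       | inj₁ refl       = refl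
  ... | inj₁ refl       | inj₂ (j , refl) = contradiction (trans (sym glue-u) (trans eq (glue-punchIn j))) λ ()
  ... | inj₂ (i , refl) | inj₁ refl       = contradiction (trans (sym glue-u) (trans (sym eq) (glue-punchIn i))) λ ()
  ... | inj₂ (i , refl) | inj₂ (j , refl) =
    cong (punchIn u) (inject-injective (suc-injective (trans (sym (glue-punchIn i)) (trans eq (glue-punchIn j)))))

  embedding : InducedEmbedding G H
  embedding = record { embed = glue ; injective = glue-injective ; adj-embed = adj-glue }

  nbrsEmbedded : ∀ i → NbrsEmbedded embedding (punchIn u i)
  nbrsEmbedded i zero    _   = u , glue-u
  nbrsEmbedded i (suc y) ι~y with nbrs-inject i y (subst (λ w → Adj H w (suc y) ≡ true) (glue-punchIn i) ι~y)
  ... | j , refl = punchIn u j , glue-punchIn j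

  pullback-≡ : ∀ {T F} → lookup T zero ≡ lookup F u →
    (∀ i → lookup T (suc (inject i)) ≡ lookup F (punchIn u i)) → pullback embedding T ≡ F
  pullback-≡ {T} {F} T₀≡Fᵤ T∘inject≡F∘punchIn = trans (tabulate-cong pointwise) (tabulate∘lookup F)
    where
    pointwise : ∀ x → lookup T (glue x) ≡ lookup F x
    pointwise x with ≡⊎punchIn u x
    ... | inj₁ refl       = trans (cong (lookup T) glue-u) T₀≡Fᵤ
    ... | inj₂ (i , refl) = trans (cong (lookup T) (glue-punchIn i)) (T∘inject≡F∘punchIn i)

  module _ {T : Subset (suc N)} (i : Fin n) where

    pullback-isFort⇒¬exactlyOneNbrIn-inject : IsFort G (pullback embedding T) →
      suc (inject i) ∉ T → ¬ ExactlyOneNbrIn H T (suc (inject i))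
    pullback-isFort⇒¬exactlyOneNbrIn-inject fortT* =
      subst (λ w → w ∉ T → ¬ ExactlyOneNbrIn H T w) (glue-punchIn i)
            (pullback-isFort⇒¬exactlyOneNbrIn embedding fortT* (nbrsEmbedded i))

    minimal-pullback⇒subfort-covers-inject : IsMinimalFort G (pullback embedding T) →
      ∀ {S} → S ⊆ T → zero ∈ S → IsFort H S → suc (inject i) ∈ T → ¬ suc (inject i) ∉ S
    minimal-pullback⇒subfort-covers-inject (_ , minimal) {S} S⊆T 0∈S fortS ι∈T ι∉S =
      minimal (pullback embedding S) S*⊂T* fortS*
      where
      u∈S* : u ∈ pullback embedding S
      u∈S* = ∈-pullback⁺ embedding (subst (_∈ S) (sym glue-u) 0∈S)

      nbrsOutside : ∀ x → x ∉ pullback embedding S → NbrsEmbedded embedding x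
      nbrsOutside x x∉S* with ≡⊎punchIn u x
      ... | inj₁ refl       = contradiction u∈S* x∉S*
      ... | inj₂ (j , refl) = nbrsEmbedded j

      fortS* : IsFort G (pullback embedding S)
      fortS* = pullback-isFort embedding fortS (u , u∈S*) nbrsOutside

      S*⊂T* : pullback embedding S ⊂ pullback embedding T
      S*⊂T* = pullback-⊂ embedding S⊆T (subst (_∈ T) (sym (glue-punchIn i)) ι∈T)
                                        (subst (_∉ S) (sym (glue-punchIn i)) ι∉S)

module _ {m k : ℕ} (G : Graph (suc m)) (u : Fin (suc m)) (G' : Graph (suc k)) (u' : Fin (suc k)) where

  private
    H : Graph (suc (m + k))
    H = vertexSum G u G' u'

  gluingˡ : Gluing H G u
  gluingˡ = record
    { inject           = _↑ˡ k
    ; inject-injective = ↑ˡ-injective k _ _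
    ; adj-inject       = adj-↑ˡ
    ; adj-zero-inject  = adj-zero-↑ˡ
    ; nbrs-inject      = nbrs-↑ˡ
    }
    where
    adj-↑ˡ : ∀ i j → Adj H (suc (i ↑ˡ k)) (suc (j ↑ˡ k)) ≡ Adj G (punchIn u i) (punchIn u j)
    adj-↑ˡ i j rewrite splitAt-↑ˡ m i k | splitAt-↑ˡ m j k = refl

    adj-zero-↑ˡ : ∀ i → Adj H zero (suc (i ↑ˡ k)) ≡ Adj G u (punchIn u i)
    adj-zero-↑ˡ i rewrite splitAt-↑ˡ m i k = refl

    nbrs-↑ˡ : ∀ i y → Adj H (suc (i ↑ˡ k)) (suc y) ≡ true → ∃ λ j → j ↑ˡ k ≡ y
    nbrs-↑ˡ i y i~y rewrite splitAt-↑ˡ m i k with splitAt m y in eq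
    ... | inj₁ j = j , splitAt⁻¹-↑ˡ eq
    ... | inj₂ _ = contradiction i~y λ ()

  gluingʳ : Gluing H G' u'
  gluingʳ = record
    { inject           = m ↑ʳ_
    ; inject-injective = ↑ʳ-injective m _ _
    ; adj-inject       = adj-↑ʳ
    ; adj-zero-inject  = adj-zero-↑ʳ
    ; nbrs-inject      = nbrs-↑ʳ
    }
    where
    adj-↑ʳ : ∀ i j → Adj H (suc (m ↑ʳ i)) (suc (m ↑ʳ j)) ≡ Adj G' (punchIn u' i) (punchIn u' j)
    adj-↑ʳ i j rewrite splitAt-↑ʳ m k i | splitAt-↑ʳ m k j = refl

    adj-zero-↑ʳ : ∀ i → Adj H zero (suc (m ↑ʳ i)) ≡ Adj G' u' (punchIn u' i)
    adj-zero-↑ʳ i rewrite splitAt-↑ʳ m k i = refl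

    nbrs-↑ʳ : ∀ i y → Adj H (suc (m ↑ʳ i)) (suc y) ≡ true → ∃ λ j → m ↑ʳ j ≡ y
    nbrs-↑ʳ i y i~y rewrite splitAt-↑ʳ m k i with splitAt m y in eq
    ... | inj₁ _ = contradiction i~y λ ()
    ... | inj₂ j = j , splitAt⁻¹-↑ʳ eq

  data VertexSumView : Fin (suc (m + k)) → Set where
    new   : VertexSumView zero
    left  : ∀ i → VertexSumView (suc (i ↑ˡ k))
    right : ∀ j → VertexSumView (suc (m ↑ʳ j))

  vertexSumView : ∀ w → VertexSumView w
  vertexSumView zero = new
  vertexSumView (suc w) with splitAt m w in eq
  ... | inj₁ i = subst (VertexSumView ∘ suc) (splitAt⁻¹-↑ˡ eq) (left i)
  ... | inj₂ j = subst (VertexSumView ∘ suc) (splitAt⁻¹-↑ʳ eq) (right j)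

  module _ {F : Subset (suc m)} {F' : Subset (suc k)} where

    private
      F̂ : Subset (suc (m + k))
      F̂ = fHat G u G' u' F F'

      F̂-suc : ∀ w → lookup F̂ (suc w) ≡ fHatSide G u G' u' F F' (inj₂ (splitAt m w))
      F̂-suc = lookup∘tabulate (λ w → fHatSide G u G' u' F F' (inj₂ (splitAt m w)))

    pullbackˡ-fHat : u ∈ F → pullback (embedding gluingˡ) F̂ ≡ F
    pullbackˡ-fHat u∈F = pullback-≡ gluingˡ {T = F̂} (sym ([]=⇒lookup u∈F)) λ i →
      trans (F̂-suc (i ↑ˡ k)) (cong (λ s → fHatSide G u G' u' F F' (inj₂ s)) (splitAt-↑ˡ m i k))

    pullbackʳ-fHat : u' ∈ F' → pullback (embedding gluingʳ) F̂ ≡ F'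
    pullbackʳ-fHat u'∈F' = pullback-≡ gluingʳ {T = F̂} (sym ([]=⇒lookup u'∈F')) λ j →
      trans (F̂-suc (m ↑ʳ j)) (cong (λ s → fHatSide G u G' u' F F' (inj₂ s)) (splitAt-↑ʳ m k j))

    fHat-isFort : IsFort G F → IsFort G' F' → u ∈ F → u' ∈ F' → IsFort H F̂
    fHat-isFort fortF fortF' u∈F u'∈F' = (vNew G u G' u' , here) , outside
      where
      outside : ∀ w → w ∉ F̂ → ¬ ExactlyOneNbrIn H F̂ w
      outside w with vertexSumView w
      ... | new     = λ v∉F̂ → contradiction here v∉F̂
      ... | left i  = pullback-isFort⇒¬exactlyOneNbrIn-inject gluingˡ i
                        (subst (IsFort G) (sym (pullbackˡ-fHat u∈F)) fortF)
      ... | right j = pullback-isFort⇒¬exactlyOneNbrIn-inject gluingʳ j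
                        (subst (IsFort G') (sym (pullbackʳ-fHat u'∈F')) fortF')

    fHat-minimalThrough-vNew : IsMinimalFort G F → IsMinimalFort G' F' → u ∈ F → u' ∈ F' →
      ∀ S → S ⊂ F̂ → vNew G u G' u' ∈ S → ¬ IsFort H S
    fHat-minimalThrough-vNew minF minF' u∈F u'∈F' S (S⊆F̂ , w , w∈F̂ , w∉S) v∈S fortS
      with vertexSumView w
    ... | new     = w∉S v∈S
    ... | left i  = minimal-pullback⇒subfort-covers-inject gluingˡ i
                      (subst (IsMinimalFort G) (sym (pullbackˡ-fHat u∈F)) minF) S⊆F̂ v∈S fortS w∈F̂ w∉S
    ... | right j = minimal-pullback⇒subfort-covers-inject gluingʳ j
                      (subst (IsMinimalFort G') (sym (pullbackʳ-fHat u'∈F')) minF') S⊆F̂ v∈S fortS w∈F̂ w∉S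

corollary5p7 : ∀ {m k : ℕ} (G : Graph (suc m)) (u : Fin (suc m))
    (G' : Graph (suc k)) (u' : Fin (suc k))
    (F : Subset (suc m)) (F' : Subset (suc k)) →
    IsMinimalFort G F → IsMinimalFort G' F' → u ∈ F → u' ∈ F' →
    IsFort (vertexSum G u G' u') (fHat G u G' u' F F')
    × (IsMinimalFort (vertexSum G u G' u') (fHat G u G' u' F F')
       ⇔ (¬ Σ (Subset (suc (m + k))) λ S →
             S ⊆ (fHat G u G' u' F F' - vNew G u G' u')
             × IsFort (vertexSum G u G' u') S))
corollary5p7 G u G' u' F F' minF minF' u∈F u'∈F' =
  fortF̂ , mk⇔ (λ minF̂ → minimalFort⇒¬containsFort- {G = H} minF̂ here)
              (λ noFortAvoiding → isMinimalFort⁺ {G = H} {y = vNew G u G' u'} fortF̂ noFortAvoiding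
                                    (fHat-minimalThrough-vNew G u G' u' minF minF' u∈F u'∈F'))
  where
  H : Graph _
  H = vertexSum G u G' u'

  fortF̂ : IsFort H (fHat G u G' u' F F')
  fortF̂ = fHat-isFort G u G' u' (proj₁ minF) (proj₁ minF') u∈F u'∈F'
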